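{- Let $\mathcal{F}$ be a family of graphs. Then every graph $G\in\{T\vee I_{n+1-\beta'(\mathcal{F})}: T\in\mathrm{Ex}(\beta'(\mathcal{F})-1,\mathcal{H}(\mathcal{F}))\}$ is $\mathcal{F}$-free.
   Context: A graph is $\mathcal{F}$-free if it contains no member of $\mathcal{F}$ as a subgraph; $\mathrm{Ex}(m,\mathcal{H})$ is the set of $\mathcal{H}$-free graphs on $m$ vertices with the maximum number of edges. A covering of a graph is a vertex set meeting all its edges; $\beta(G)$ / $\beta'(G)$ is the minimum size of a covering / independent covering ($\beta'(G)=+\infty$ if $G$ is not bipartite); $\beta(\mathcal{F}),\beta'(\mathcal{F})$ are minima over members of $\mathcal{F}$. $\mathcal{M}(\mathcal{F})=\{F[S]: F\in\mathcal{F},\ S\text{ a covering of }F,\ |S|<\beta'(\mathcal{F})\}$; $\mathcal{H}(\mathcal{F})=\{K_{\beta'(\mathcal{F})}\}$ if $\beta'(\mathcal{F})=\beta(\mathcal{F})$ and $\mathcal{H}(\mathcal{F})=\mathcal{M}(\mathcal{F})$ if $\beta'(\mathcal{F})>\beta(\mathcal{F})$. $\vee$ is the join, $I_m$ the edgeless graph on $m$ vertices. -}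

module Defs where

open import Data.Nat using (ℕ; zero; suc; _+_; _∸_; _≤_; _<_; _<ᵇ_)
open import Data.Bool using (Bool; true; false; not; _∧_; if_then_else_)
open import Data.Fin using (Fin; toℕ; splitAt; _≟_)
open import Data.Fin.Subset using (Subset; _∈_; ∣_∣)
open import Data.Sum using (_⊎_; inj₁; inj₂)
open import Data.Product using (Σ; ∃; _×_; _,_)
open import Data.List using (List; map)
open import Data.Nat.ListAction using (sum)
open import Data.List.Base using () renaming (allFin to allFinL)
open import Data.Empty using (⊥)
open import Relation.Nullary using (¬_; yes; no)
open import Relation.Nullary.Decidable using (⌊_⌋)
open import Relation.Binary.PropositionalEquality using (_≡_; refl; sym)
open import Function.Definitions using (Injective)

record Graph : Set where
  field
    V      : ℕ
    adj    : Fin V → Fin V → Bool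
    adj-sym    : ∀ u v → adj u v ≡ adj v u
    adj-irrefl : ∀ v → adj v v ≡ false
open Graph public

Family : Set₁
Family = Graph → Set

_⊆G_ : Graph → Graph → Set
F ⊆G G = Σ (Fin (V F) → Fin (V G)) λ φ →
  Injective _≡_ _≡_ φ × (∀ u v → adj F u v ≡ true → adj G (φ u) (φ v) ≡ true)

Free : Family → Graph → Set
Free 𝓕 G = ∀ F → 𝓕 F → ¬ (F ⊆G G)

edges : Graph → ℕ
edges G = sum (map (λ i → sum (map (λ j →
  if (toℕ j <ᵇ toℕ i) ∧ adj G i j then 1 else 0) (allFinL (V G)))) (allFinL (V G)))

InEx : ℕ → Family → Graph → Set
InEx m 𝓗 T = (V T ≡ m) × Free 𝓗 T ×
  (∀ T′ → V T′ ≡ m → Free 𝓗 T′ → edges T′ ≤ edges T)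

IsCovering : (G : Graph) → Subset (V G) → Set
IsCovering G S = ∀ u v → adj G u v ≡ true → (u ∈ S) ⊎ (v ∈ S)

IsIndependent : (G : Graph) → Subset (V G) → Set
IsIndependent G S = ∀ u v → u ∈ S → v ∈ S → adj G u v ≡ false

IsBeta : Family → ℕ → Set
IsBeta 𝓕 b = (Σ Graph λ F → 𝓕 F × Σ (Subset (V F)) λ S → IsCovering F S × ∣ S ∣ ≡ b)
  × (∀ F → 𝓕 F → ∀ S → IsCovering F S → b ≤ ∣ S ∣)

-- b′ = β′(𝓕) (finite) = min over F ∈ 𝓕 of the minimum independent covering size
-- (non-bipartite graphs have no independent covering, i.e. β′ = +∞)
IsBeta′ : Family → ℕ → Set
IsBeta′ 𝓕 b′ = (Σ Graph λ F → 𝓕 F × Σ (Subset (V F)) λ S →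
      IsCovering F S × IsIndependent F S × ∣ S ∣ ≡ b′)
  × (∀ F → 𝓕 F → ∀ S → IsCovering F S → IsIndependent F S → b′ ≤ ∣ S ∣)

Induced : (G : Graph) {k : ℕ} → (Fin k → Fin (V G)) → Graph
Induced G {k} ι = record
  { V = k
  ; adj = λ i j → adj G (ι i) (ι j)
  ; adj-sym = λ i j → adj-sym G (ι i) (ι j)
  ; adj-irrefl = λ i → adj-irrefl G (ι i) }

-- M(𝓕) with β′(𝓕) = b′: graphs F[S], F ∈ 𝓕, S a covering of F with |S| < b′.
-- S is given by an injective enumeration ι : Fin k → Fin (V F) (k = |S|).
M : Family → ℕ → Family
M 𝓕 b′ H = Σ Graph λ F → 𝓕 F × Σ ℕ λ k → Σ (Fin k → Fin (V F)) λ ι →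
  Injective _≡_ _≡_ ι × k < b′ ×
  (∀ u v → adj F u v ≡ true → (∃ λ i → ι i ≡ u) ⊎ (∃ λ i → ι i ≡ v)) ×
  H ≡ Induced F ι

K : ℕ → Graph
K n = record { V = n ; adj = λ i j → not ⌊ i ≟ j ⌋ ; adj-sym = s ; adj-irrefl = r }
  where
  s : ∀ (i j : Fin n) → not ⌊ i ≟ j ⌋ ≡ not ⌊ j ≟ i ⌋
  s i j with i ≟ j | j ≟ i
  ... | yes _ | yes _ = refl
  ... | no _ | no _ = refl
  ... | yes p | no q with q (sym p)
  ... | ()
  s i j | no p | yes q with p (sym q)
  ... | ()
  r : ∀ (i : Fin n) → not ⌊ i ≟ i ⌋ ≡ false
  r i with i ≟ i
  ... | yes _ = refl
  ... | no p with p refl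
  ... | ()

I : ℕ → Graph
I m = record { V = m ; adj = λ _ _ → false ; adj-sym = λ _ _ → refl ; adj-irrefl = λ _ → refl }

joinAdj : (G H : Graph) → Fin (V G) ⊎ Fin (V H) → Fin (V G) ⊎ Fin (V H) → Bool
joinAdj G H (inj₁ i) (inj₁ j) = adj G i j
joinAdj G H (inj₁ i) (inj₂ j) = true
joinAdj G H (inj₂ i) (inj₁ j) = true
joinAdj G H (inj₂ i) (inj₂ j) = adj H i j

joinAdj-sym : ∀ G H x y → joinAdj G H x y ≡ joinAdj G H y x
joinAdj-sym G H (inj₁ i) (inj₁ j) = adj-sym G i j
joinAdj-sym G H (inj₁ i) (inj₂ j) = refl
joinAdj-sym G H (inj₂ i) (inj₁ j) = refl
joinAdj-sym G H (inj₂ i) (inj₂ j) = adj-sym H i j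

joinAdj-irrefl : ∀ G H x → joinAdj G H x x ≡ false
joinAdj-irrefl G H (inj₁ i) = adj-irrefl G i
joinAdj-irrefl G H (inj₂ i) = adj-irrefl H i

_∨G_ : Graph → Graph → Graph
G ∨G H = record
  { V = V G + V H
  ; adj = λ x y → joinAdj G H (splitAt (V G) x) (splitAt (V G) y)
  ; adj-sym = λ x y → joinAdj-sym G H (splitAt (V G) x) (splitAt (V G) y)
  ; adj-irrefl = λ x → joinAdj-irrefl G H (splitAt (V G) x) }

-- 𝓗(𝓕), given b = β(𝓕) and b′ = β′(𝓕) (always b ≤ b′)
HF : Family → ℕ → ℕ → Family
HF 𝓕 b b′ H = (b ≡ b′ × H ≡ K b′) ⊎ (b < b′ × M 𝓕 b′ H)

-- Let φ embed some F ∈ 𝓕 into T ∨ I. The vertices of F landing in T form a covering S of F,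
-- since I is edgeless, and F[S] embeds into T, so |S| ≤ |T| = β′ − 1 < β′. If β = β′ this
-- covering is smaller than β(𝓕); if β < β′ then F[S] ∈ 𝓜(𝓕) = 𝓗(𝓕), which T avoids.
-- Only the 𝓗(𝓕)-freeness of T is used, not its extremality.
module Submission where

open import Defs
open import Data.Nat using (ℕ; _+_; _∸_; _≤_; _<_; s≤s; z≤n)
open import Data.Nat.Properties using (≤-trans; ≤-reflexive; ≤-<-trans; <⇒≱; m≤n⇒m<n∨m≡n; ∸-monoʳ-<)
open import Data.Fin using (Fin; zero; suc; splitAt; join)
open import Data.Fin.Properties using (suc-injective; injective⇒≤; join-splitAt)
open import Data.Fin.Subset using (Subset; Side; inside; outside; _∈_; ∣_∣)
open import Data.Fin.Subset.Properties using (drop-there)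
open import Data.Vec using ([]; _∷_; here; there; tabulate)
open import Data.Vec.Properties using ([]=⇒lookup; lookup⇒[]=; lookup∘tabulate)
open import Data.Sum using (_⊎_; inj₁; inj₂) renaming (map to ⊎-map)
open import Data.Product using (∃; _,_; proj₁; proj₂; map; map₂)
open import Data.Bool using (false; true)
open import Function using (_∘_; case_of_)
open import Function.Definitions using (Injective)
open import Relation.Binary.PropositionalEquality using (_≡_; refl; sym; trans; cong; subst; subst₂)

record Enumeration {n : ℕ} (S : Subset n) : Set where
  field
    index           : Fin ∣ S ∣ → Fin n
    index-injective : Injective _≡_ _≡_ index
    index-∈         : ∀ i → index i ∈ S
    index-onto      : ∀ {u} → u ∈ S → ∃ λ i → index i ≡ u

enumerate : ∀ {n} (S : Subset n) → Enumeration S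
enumerate [] = record
  { index = λ ()
  ; index-injective = λ { {()} }
  ; index-∈ = λ ()
  ; index-onto = λ ()
  }
enumerate (outside ∷ S) = record
  { index = suc ∘ index
  ; index-injective = index-injective ∘ suc-injective
  ; index-∈ = there ∘ index-∈
  ; index-onto = λ { {suc u} u∈ → map₂ (cong suc) (index-onto (drop-there u∈)) }
  }
  where open Enumeration (enumerate S)
enumerate (inside ∷ S) = record
  { index = index′
  ; index-injective = injective′
  ; index-∈ = λ { zero → here ; (suc i) → there (index-∈ i) }
  ; index-onto = onto′
  }
  where
  open Enumeration (enumerate S)
  index′ : Fin ∣ inside ∷ S ∣ → Fin _
  index′ zero    = zero
  index′ (suc i) = suc (index i)
  injective′ : Injective _≡_ _≡_ index′
  injective′ {zero}  {zero}  _ = refl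
  injective′ {suc i} {suc j} e = cong suc (index-injective (suc-injective e))
  onto′ : ∀ {u} → u ∈ inside ∷ S → ∃ λ i → index′ i ≡ u
  onto′ {zero}  _  = zero , refl
  onto′ {suc u} u∈ = map suc (cong suc) (index-onto (drop-there u∈))

enumeration-covers : ∀ {F : Graph} {S : Subset (V F)} (E : Enumeration S) → IsCovering F S →
  let open Enumeration E in
  ∀ u v → adj F u v ≡ true → (∃ λ i → index i ≡ u) ⊎ (∃ λ i → index i ≡ v)
enumeration-covers E cover u v uv = ⊎-map index-onto index-onto (cover u v uv)
  where open Enumeration E

splitAt-injective : ∀ m {n} {x y : Fin (m + n)} → splitAt m x ≡ splitAt m y → x ≡ y
splitAt-injective m {n} {x} {y} e =
  trans (sym (join-splitAt m n x)) (trans (cong (join m n) e) (join-splitAt m n y))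

isLeft : ∀ {A B : Set} → A ⊎ B → Side
isLeft (inj₁ _) = inside
isLeft (inj₂ _) = outside

fromLeft : ∀ {A B : Set} (x : A ⊎ B) → isLeft x ≡ inside → A
fromLeft (inj₁ a) _ = a

inj₁-fromLeft : ∀ {A B : Set} (x : A ⊎ B) (p : isLeft x ≡ inside) → inj₁ (fromLeft x p) ≡ x
inj₁-fromLeft (inj₁ a) _ = refl

∈-tabulate : ∀ {n} (f : Fin n → Side) {u} → u ∈ tabulate f → f u ≡ inside
∈-tabulate f {u} u∈ = trans (sym (lookup∘tabulate f u)) ([]=⇒lookup u∈)

tabulate-∈ : ∀ {n} (f : Fin n → Side) {u} → f u ≡ inside → u ∈ tabulate f
tabulate-∈ f {u} fu = lookup⇒[]= u (tabulate f) (trans (lookup∘tabulate f u) fu)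

Edgeless : Graph → Set
Edgeless H = ∀ u v → adj H u v ≡ false

joinAdj-edgeless : ∀ G H → Edgeless H → ∀ x y → joinAdj G H x y ≡ true →
  isLeft x ≡ inside ⊎ isLeft y ≡ inside
joinAdj-edgeless G H _ (inj₁ _) _        _  = inj₁ refl
joinAdj-edgeless G H _ (inj₂ _) (inj₁ _) _  = inj₂ refl
joinAdj-edgeless G H edgeless (inj₂ u) (inj₂ v) uv with () ← trans (sym uv) (edgeless u v)

module JoinPreimage {F G H : Graph} (embedding : F ⊆G (G ∨G H)) where

  private
    φ = proj₁ embedding
    φ-injective = proj₁ (proj₂ embedding)
    φ-adj = proj₂ (proj₂ embedding)

    part : Fin (V F) → Fin (V G) ⊎ Fin (V H)
    part = splitAt (V G) ∘ φ

  leftPreimage : Subset (V F)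
  leftPreimage = tabulate (isLeft ∘ part)

  leftPreimage-covering : Edgeless H → IsCovering F leftPreimage
  leftPreimage-covering edgeless u v uv =
    ⊎-map (tabulate-∈ (isLeft ∘ part)) (tabulate-∈ (isLeft ∘ part))
      (joinAdj-edgeless G H edgeless (part u) (part v) (φ-adj u v uv))

  open Enumeration (enumerate leftPreimage) public

  private
    index-left : ∀ i → isLeft (part (index i)) ≡ inside
    index-left i = ∈-tabulate (isLeft ∘ part) (index-∈ i)

    restriction : Fin ∣ leftPreimage ∣ → Fin (V G)
    restriction i = fromLeft (part (index i)) (index-left i)

    part-restriction : ∀ i → inj₁ (restriction i) ≡ part (index i)
    part-restriction i = inj₁-fromLeft (part (index i)) (index-left i)

    restriction-injective : Injective _≡_ _≡_ restriction
    restriction-injective {i} {j} e = index-injective (φ-injective (splitAt-injective (V G)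
      (trans (sym (part-restriction i)) (trans (cong inj₁ e) (part-restriction j)))))

    restriction-adj : ∀ i j → adj F (index i) (index j) ≡ true →
      adj G (restriction i) (restriction j) ≡ true
    restriction-adj i j ij = subst₂ (λ x y → joinAdj G H x y ≡ true)
      (sym (part-restriction i)) (sym (part-restriction j)) (φ-adj (index i) (index j) ij)

  induced-leftPreimage-⊆G : Induced F index ⊆G G
  induced-leftPreimage-⊆G = restriction , restriction-injective , restriction-adj

  ∣leftPreimage∣≤V : ∣ leftPreimage ∣ ≤ V G
  ∣leftPreimage∣≤V = injective⇒≤ restriction-injective

β≤β′ : ∀ {𝓕 b b′} → IsBeta 𝓕 b → IsBeta′ 𝓕 b′ → b ≤ b′
β≤β′ (_ , β-minimal) ((F , F∈𝓕 , S , covering , _ , ∣S∣≡b′) , _) =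
  ≤-trans (β-minimal F F∈𝓕 S covering) (≤-reflexive ∣S∣≡b′)

lemma3p2 : (𝓕 : Family) (b b′ : ℕ) → IsBeta 𝓕 b → IsBeta′ 𝓕 b′ → 1 ≤ b′ →
    (n : ℕ) → b′ ≤ n + 1 →
    (T : Graph) → InEx (b′ ∸ 1) (HF 𝓕 b b′) T →
    Free 𝓕 (T ∨G I (n + 1 ∸ b′))
lemma3p2 𝓕 b b′ β β′ 1≤b′ n _ T (VT≡ , T-free , _) F F∈𝓕 embedding =
  case m≤n⇒m<n∨m≡n (β≤β′ β β′) of λ where
    (inj₁ b<b′) → T-free (Induced F index)
      (inj₂ (b<b′ , F , F∈𝓕 , ∣ leftPreimage ∣ , index , index-injective , ∣leftPreimage∣<b′ ,
             enumeration-covers {F} (enumerate leftPreimage) covering , refl))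
      induced-leftPreimage-⊆G
    (inj₂ b≡b′) → <⇒≱ ∣leftPreimage∣<b′
      (subst (_≤ ∣ leftPreimage ∣) b≡b′ (proj₂ β F F∈𝓕 leftPreimage covering))
  where
  open JoinPreimage {F} {T} {I (n + 1 ∸ b′)} embedding
  covering : IsCovering F leftPreimage
  covering = leftPreimage-covering (λ _ _ → refl)
  ∣leftPreimage∣<b′ : ∣ leftPreimage ∣ < b′
  ∣leftPreimage∣<b′ = ≤-<-trans (≤-trans ∣leftPreimage∣≤V (≤-reflexive VT≡)) (∸-monoʳ-< (s≤s z≤n) 1≤b′)
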